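{- Let $X$ be a finite set and let $\mathcal{D}\subseteq\mathcal{R}(X)$ be a connected domain. Then $\mathcal{D}$ is a median domain if and only if its associated graph $\Gamma_{\mathcal{D}}$ is a median graph.
   Context: $\mathcal{R}(X)$ is the set of strict linear orders on $X$. For $R,R'\in\mathcal{R}(X)$ let $[R,R']=\{Q\in\mathcal{R}(X): Q\supseteq R\cap R'\}$. $\mathcal{D}$ is a median domain if for all $R_1,R_2,R_3\in\mathcal{D}$ there is $R\in\mathcal{D}\cap[R_1,R_2]\cap[R_1,R_3]\cap[R_2,R_3]$. $\Gamma_{\mathcal{D}}$ is the graph on $\mathcal{D}$ in which distinct $R,R'$ are adjacent iff $[R,R']\cap\mathcal{D}=\{R,R'\}$. $\mathcal{D}$ is connected if any two adjacent vertices of $\Gamma_{\mathcal{D}}$ differ only by swapping one pair of alternatives adjacent in both orders (i.e., $\Gamma_{\mathcal{D}}$ is a subgraph of the permutohedron). A median graph is a connected graph in which any three vertices $u,v,w$ have a unique vertex lying on some shortest path between each pair of them. -}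

module Defs where

open import Data.Nat using (ℕ; suc; _≤_)
open import Data.Fin using (Fin)
open import Data.Bool using (Bool; T)
open import Data.Vec using (Vec; lookup)
open import Data.Product using (Σ; _×_; _,_; ∃; proj₁)
open import Data.Sum using (_⊎_)
open import Relation.Nullary using (¬_)
open import Relation.Binary.PropositionalEquality using (_≡_; _≢_)
open import Data.Empty using (⊥)

-- Binary relations on X = Fin n, stored as Boolean n×n matrices
-- (so that equality of relations is propositional equality).
-- rel R x y holds iff (x , y) ∈ R.

Rel : ℕ → Set
Rel n = Vec (Vec Bool n) n

rel : ∀ {n} → Rel n → Fin n → Fin n → Set
rel R x y = T (lookup (lookup R x) y)

IsLinOrd : ∀ {n} → Rel n → Set
IsLinOrd {n} R =
  (∀ x → ¬ rel R x x) ×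
  (∀ x y z → rel R x y → rel R y z → rel R x z) ×
  (∀ x y → x ≢ y → rel R x y ⊎ rel R y x)

InInterval : ∀ {n} → Rel n → Rel n → Rel n → Set
InInterval R R' Q = IsLinOrd Q × (∀ x y → rel R x y → rel R' x y → rel Q x y)

Domain : ℕ → Set
Domain n = Rel n → Bool

_∈D_ : ∀ {n} → Rel n → Domain n → Set
R ∈D D = T (D R)

IsDomain : ∀ {n} → Domain n → Set
IsDomain D = ∀ R → R ∈D D → IsLinOrd R

IsMedianDomain : ∀ {n} → Domain n → Set
IsMedianDomain D = ∀ R₁ R₂ R₃ → R₁ ∈D D → R₂ ∈D D → R₃ ∈D D →
  Σ _ λ R → R ∈D D × InInterval R₁ R₂ R × InInterval R₁ R₃ R × InInterval R₂ R₃ R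

Vertex : ∀ {n} → Domain n → Set
Vertex D = Σ _ λ R → R ∈D D

Adj : ∀ {n} (D : Domain n) → Vertex D → Vertex D → Set
Adj D (R , _) (R' , _) =
  R ≢ R' ×
  (∀ Q → Q ∈D D → InInterval R R' Q → Q ≡ R ⊎ Q ≡ R')

SwapAdjacent : ∀ {n} → Rel n → Rel n → Set
SwapAdjacent {n} R R' = Σ (Fin n) λ a → Σ (Fin n) λ b →
  a ≢ b × rel R a b × rel R' b a ×
  (∀ c → ¬ (rel R a c × rel R c b)) ×
  (∀ c → ¬ (rel R' b c × rel R' c a)) ×
  (∀ x y → ¬ (x ≡ a × y ≡ b) → ¬ (x ≡ b × y ≡ a) → rel R x y → rel R' x y) ×
  (∀ x y → ¬ (x ≡ a × y ≡ b) → ¬ (x ≡ b × y ≡ a) → rel R' x y → rel R x y)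

IsConnectedDomain : ∀ {n} → Domain n → Set
IsConnectedDomain D = ∀ u v → Adj D u v → SwapAdjacent (proj₁ u) (proj₁ v)

module _ {V : Set} (E : V → V → Set) where

  data Walk : V → V → Set where
    []  : ∀ {u} → Walk u u
    _∷_ : ∀ {u v w} → E u v → Walk v w → Walk u w

  len : ∀ {u v} → Walk u v → ℕ
  len []       = 0
  len (_ ∷ p) = suc (len p)

  data OnWalk (x : V) : ∀ {u v} → Walk u v → Set where
    here  : ∀ {v} {p : Walk x v} → OnWalk x p
    there : ∀ {u w v} {e : E u w} {p : Walk w v} → OnWalk x p → OnWalk x (e ∷ p)

  Shortest : ∀ {u v} → Walk u v → Set
  Shortest {u} {v} p = ∀ (q : Walk u v) → len p ≤ len q

  OnGeodesic : V → V → V → Set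
  OnGeodesic u v x = Σ (Walk u v) λ p → Shortest p × OnWalk x p

  IsConnectedGraph : Set
  IsConnectedGraph = ∀ u v → Walk u v

  IsMedianGraph : Set
  IsMedianGraph = IsConnectedGraph ×
    (∀ u v w → Σ V λ m →
       (OnGeodesic u v m × OnGeodesic u w m × OnGeodesic v w m) ×
       (∀ m' → OnGeodesic u v m' → OnGeodesic u w m' → OnGeodesic v w m' → m' ≡ m))

module Submission where

-- The proof identifies the shortest-path metric of Γ_𝒟 with the Kendall
-- distance τ(R, S) = #{(a, b) : a R b and b S a} between linear orders.
--   1. For linear R, S, Q: τ(R, Q) + τ(Q, S) ≤ τ(R, S) iff Q ∈ [R, S]
--      (the triangle inequality holds pairwise, and is tight exactly on
--      the interval).  Conversely
--      a walk of length τ(R, S) exists: either some order of 𝒟 lies strictly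
--      inside [R, S] (found by exhaustive search; split there and recurse),
--      or R and S are adjacent.
--   3. In any graph whose path metric is a given function d, the vertices
--      on geodesics from u to v are those with d u x + d x v ≤ d u v; for
--      Γ_𝒟 these are, by 1, exactly the orders of 𝒟 in [R, S].
--   4. A linear order lying in all three pairwise intervals of R₁, R₂, R₃
--      is the majority relation, hence unique.
-- The theorem then translates medians of 𝒟 into medians of Γ_𝒟 and back.

open import Defs
open import Data.Nat using (ℕ; zero; suc; _+_; _≤_; _<_; z≤n; s≤s)
open import Data.Nat.Properties
  using ( +-0-commutativeMonoid; +-assoc; +-comm; +-mono-≤; +-monoˡ-≤; +-monoʳ-≤
        ; +-cancelˡ-≤; +-cancelʳ-≤; ≤-refl; ≤-reflexive; ≤-trans; <-≤-trans
        ; <⇒≱; ≰⇒>; m≤n+m; m+n≤o⇒m≤o; m<m+n; m<n+m; module ≤-Reasoning )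
open import Algebra.Properties.CommutativeMonoid.Sum +-0-commutativeMonoid
  using (sum; ∑-distrib-+; sum-cong-≗; sum-replicate-zero)
open import Data.Fin using (Fin; zero; suc)
open import Data.Fin.Properties using (all?; suc-injective) renaming (_≟_ to _≟F_)
open import Data.Bool using (Bool; true; false; T; _∧_)
open import Data.Bool.Properties using (T?; T-irrelevant; T-∧) renaming (_≟_ to _≟B_)
open import Data.Vec using (Vec; []; _∷_; lookup; tabulate)
open import Data.Vec.Properties using (≡-dec; tabulate∘lookup; tabulate-cong)
open import Data.Product using (Σ; _×_; _,_; proj₁; proj₂)
open import Data.Sum using (_⊎_; inj₁; inj₂)
open import Data.Empty using (⊥-elim)
open import Data.Unit using (tt)
open import Relation.Nullary using (¬_; Dec; yes; no)
open import Relation.Nullary.Decidable using (map′; _×-dec_; _⊎-dec_; _→-dec_; ¬?)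
open import Relation.Binary.PropositionalEquality
  using (_≡_; _≢_; refl; sym; trans; cong; module ≡-Reasoning)
open import Function.Base using (_∘_)
open import Function.Bundles using (_⇔_; mk⇔; Equivalence)

𝟙 : Bool → ℕ
𝟙 true  = 1
𝟙 false = 0

𝟙≤1 : ∀ p → 𝟙 p ≤ 1
𝟙≤1 true  = ≤-refl
𝟙≤1 false = z≤n

𝟙-pos : ∀ {p} → T p → 1 ≤ 𝟙 p
𝟙-pos {true} _ = ≤-refl

𝟙-pos⁻¹ : ∀ {p} → 1 ≤ 𝟙 p → T p
𝟙-pos⁻¹ {true} _ = tt

𝟙-mono : ∀ {p q} → (T p → T q) → 𝟙 p ≤ 𝟙 q
𝟙-mono {false}         _ = z≤n
𝟙-mono {true} {true}   _ = ≤-refl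
𝟙-mono {true} {false}  f = ⊥-elim (f tt)

𝟙-cover : ∀ {p q r} → (T p → T q ⊎ T r) → 𝟙 p ≤ 𝟙 q + 𝟙 r
𝟙-cover {false} _ = z≤n
𝟙-cover {true} {true} _ = s≤s z≤n
𝟙-cover {true} {false} {true} _ = s≤s z≤n
𝟙-cover {true} {false} {false} f with f tt
... | inj₁ ()
... | inj₂ ()

𝟙-disjoint : ∀ {p q r} → (T p → T r) → (T q → T r) → (T p → ¬ T q) → 𝟙 p + 𝟙 q ≤ 𝟙 r
𝟙-disjoint {false} {false} _ _ _ = z≤n
𝟙-disjoint {false} {true}  _ g _ = 𝟙-mono g
𝟙-disjoint {true}  {false} f _ _ = 𝟙-mono f
𝟙-disjoint {true}  {true}  _ _ h = ⊥-elim (h tt tt)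

∑-mono : ∀ {n} {f g : Fin n → ℕ} → (∀ i → f i ≤ g i) → sum f ≤ sum g
∑-mono {zero}  _   = z≤n
∑-mono {suc n} f≤g = +-mono-≤ (f≤g zero) (∑-mono (λ i → f≤g (suc i)))

∑-tight : ∀ {n} {f g : Fin n → ℕ} → (∀ i → f i ≤ g i) → sum g ≤ sum f → ∀ i → g i ≤ f i
∑-tight {suc n} {f} {g} f≤g g≤f zero =
  +-cancelʳ-≤ (sum (λ i → g (suc i))) (g zero) (f zero)
    (≤-trans g≤f (+-monoʳ-≤ (f zero) (∑-mono (λ i → f≤g (suc i)))))
∑-tight {suc n} {f} {g} f≤g g≤f (suc i) =
  ∑-tight (λ i → f≤g (suc i))
    (+-cancelˡ-≤ (g zero) _ _ (≤-trans g≤f (+-monoˡ-≤ (sum (λ i → f (suc i))) (f≤g zero)))) i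

∑-mono-but-one : ∀ {n} {f g : Fin n → ℕ} (k : Fin n) →
  (∀ i → i ≢ k → f i ≤ g i) → f k ≤ g k + 1 → sum f ≤ sum g + 1
∑-mono-but-one {suc n} {f} {g} zero f≤g fk≤ = begin
  f zero + sum (λ i → f (suc i))  ≤⟨ +-mono-≤ fk≤ (∑-mono (λ i → f≤g (suc i) (λ ()))) ⟩
  g zero + 1 + sum (λ i → g (suc i)) ≡⟨ +-assoc (g zero) 1 _ ⟩
  g zero + (1 + sum (λ i → g (suc i))) ≡⟨ cong (g zero +_) (+-comm 1 _) ⟩
  g zero + (sum (λ i → g (suc i)) + 1) ≡⟨ +-assoc (g zero) _ 1 ⟨
  g zero + sum (λ i → g (suc i)) + 1 ∎
  where open ≤-Reasoning
∑-mono-but-one {suc n} {f} {g} (suc k) f≤g fk≤ = begin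
  f zero + sum (λ i → f (suc i))       ≤⟨ +-mono-≤ (f≤g zero λ ()) (∑-mono-but-one k tail≤ fk≤) ⟩
  g zero + (sum (λ i → g (suc i)) + 1) ≡⟨ +-assoc (g zero) _ 1 ⟨
  g zero + sum (λ i → g (suc i)) + 1 ∎
  where
  open ≤-Reasoning
  tail≤ : ∀ i → i ≢ k → f (suc i) ≤ g (suc i)
  tail≤ i i≢k = f≤g (suc i) (λ eq → i≢k (suc-injective eq))

∑² : ∀ {n} → (Fin n → Fin n → ℕ) → ℕ
∑² f = sum (λ a → sum (f a))

∑²-mono : ∀ {n} {f g : Fin n → Fin n → ℕ} → (∀ a b → f a b ≤ g a b) → ∑² f ≤ ∑² g
∑²-mono f≤g = ∑-mono (λ a → ∑-mono (f≤g a))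

∑²-distrib-+ : ∀ {n} (f g : Fin n → Fin n → ℕ) → ∑² (λ a b → f a b + g a b) ≡ ∑² f + ∑² g
∑²-distrib-+ f g = trans (sum-cong-≗ (λ a → ∑-distrib-+ (f a) (g a)))
  (∑-distrib-+ (λ a → sum (f a)) (λ a → sum (g a)))

∑²-tight : ∀ {n} {f g : Fin n → Fin n → ℕ} → (∀ a b → f a b ≤ g a b) →
  ∑² g ≤ ∑² f → ∀ a b → g a b ≤ f a b
∑²-tight f≤g g≤f a = ∑-tight (f≤g a) (∑-tight (λ a → ∑-mono (f≤g a)) g≤f a)

∑²-zeros : ∀ n → ∑² {n} (λ _ _ → 0) ≡ 0
∑²-zeros n = trans (sum-cong-≗ {n} (λ _ → sum-replicate-zero n)) (sum-replicate-zero n)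

∑²-zero : ∀ {n} {g : Fin n → Fin n → ℕ} → ∑² g ≤ 0 → ∀ a b → g a b ≤ 0
∑²-zero {n} g≤0 = ∑²-tight (λ _ _ → z≤n) (≤-trans g≤0 (≤-reflexive (sym (∑²-zeros n))))

∑²-mono-but-one : ∀ {n} {f g : Fin n → Fin n → ℕ} (a b : Fin n) →
  (∀ x y → ¬ (x ≡ a × y ≡ b) → f x y ≤ g x y) → f a b ≤ g a b + 1 → ∑² f ≤ ∑² g + 1
∑²-mono-but-one a b f≤g fab≤ =
  ∑-mono-but-one a (λ x x≢a → ∑-mono (λ y → f≤g x y (λ (x≡a , _) → x≢a x≡a)))
    (∑-mono-but-one b (λ y y≢b → f≤g a y (λ (_ , y≡b) → y≢b y≡b)) fab≤)

T-ext : ∀ {p q} → (T p → T q) → (T q → T p) → p ≡ q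
T-ext {true}  {true}  _ _ = refl
T-ext {true}  {false} f _ = ⊥-elim (f tt)
T-ext {false} {true}  _ g = ⊥-elim (g tt)
T-ext {false} {false} _ _ = refl

lookup-ext : ∀ {A : Set} {m} {u v : Vec A m} → (∀ i → lookup u i ≡ lookup v i) → u ≡ v
lookup-ext {u = u} {v} eq = begin
  u                  ≡⟨ tabulate∘lookup u ⟨
  tabulate (lookup u) ≡⟨ tabulate-cong eq ⟩
  tabulate (lookup v) ≡⟨ tabulate∘lookup v ⟩
  v ∎
  where open ≡-Reasoning

module _ {n : ℕ} where

  entry : Rel n → Fin n → Fin n → Bool
  entry R a b = lookup (lookup R a) b

  _⊆_ : Rel n → Rel n → Set
  R ⊆ S = ∀ a b → rel R a b → rel S a b

  ⊆-antisym : {R S : Rel n} → R ⊆ S → S ⊆ R → R ≡ S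
  ⊆-antisym R⊆S S⊆R = lookup-ext (λ a → lookup-ext (λ b → T-ext (R⊆S a b) (S⊆R a b)))

  module _ {R : Rel n} (L : IsLinOrd R) where

    irrefl : ∀ {a} → ¬ rel R a a
    irrefl = proj₁ L _

    asym : ∀ {a b} → rel R a b → ¬ rel R b a
    asym ab ba = irrefl (proj₁ (proj₂ L) _ _ _ ab ba)

    distinct : ∀ {a b} → rel R a b → a ≢ b
    distinct ab refl = irrefl ab

    total : ∀ {a b} → a ≢ b → rel R a b ⊎ rel R b a
    total a≢b = proj₂ (proj₂ L) _ _ a≢b

  -- A linear order contained in another one equals it: a strict linear
  -- order is a maximal asymmetric relation.
  linear-⊆⇒≡ : {R S : Rel n} → IsLinOrd R → IsLinOrd S → R ⊆ S → R ≡ S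
  linear-⊆⇒≡ {R} {S} LR LS R⊆S = ⊆-antisym R⊆S S⊆R
    where
    S⊆R : S ⊆ R
    S⊆R a b Sab with total {R = R} LR (distinct {R = S} LS Sab)
    ... | inj₁ Rab = Rab
    ... | inj₂ Rba = ⊥-elim (asym {R = S} LS Sab (R⊆S b a Rba))

module _ {n : ℕ} where

  disagree : Rel n → Rel n → Fin n → Fin n → Bool
  disagree R S a b = entry R a b ∧ entry S b a

  disagree⇒ : ∀ R S {a b} → T (disagree R S a b) → rel R a b × rel S b a
  disagree⇒ R S = Equivalence.to T-∧

  ⇒disagree : ∀ R S {a b} → rel R a b → rel S b a → T (disagree R S a b)
  ⇒disagree R S Rab Sba = Equivalence.from T-∧ (Rab , Sba)

  τ : Rel n → Rel n → ℕ
  τ R S = ∑² (λ a b → 𝟙 (disagree R S a b))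

  via : Rel n → Rel n → Rel n → Fin n → Fin n → ℕ
  via R Q S a b = 𝟙 (disagree R Q a b) + 𝟙 (disagree Q S a b)

  τ-via : ∀ R Q S → ∑² (via R Q S) ≡ τ R Q + τ Q S
  τ-via R Q S = ∑²-distrib-+ (λ a b → 𝟙 (disagree R Q a b)) (λ a b → 𝟙 (disagree Q S a b))

  -- Pointwise triangle inequality: a pair on which R and S disagree is a
  -- disagreement of R with Q or of Q with S, whichever way Q ranks it.
  disagree-triangle : ∀ {R S Q : Rel n} → IsLinOrd R → IsLinOrd Q →
    ∀ a b → 𝟙 (disagree R S a b) ≤ via R Q S a b
  disagree-triangle {R = R} {S} {Q} LR LQ a b = 𝟙-cover λ d → split (disagree⇒ R S d)
    where
    split : rel R a b × rel S b a → T (disagree R Q a b) ⊎ T (disagree Q S a b)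
    split (Rab , Sba) with total {R = Q} LQ (distinct {R = R} LR Rab)
    ... | inj₁ Qab = inj₂ (⇒disagree Q S Qab Sba)
    ... | inj₂ Qba = inj₁ (⇒disagree R Q Rab Qba)

  -- For Q ∈ [R, S], every disagreement of R with Q or of Q with S is one of
  -- R with S, and no pair is counted twice; so τ is additive along Q.
  τ-between : ∀ {R S Q : Rel n} → IsLinOrd R → IsLinOrd S → InInterval R S Q →
    τ R Q + τ Q S ≤ τ R S
  τ-between {R} {S} {Q} LR LS (LQ , R∩S⊆Q) = begin
    τ R Q + τ Q S ≡⟨ τ-via R Q S ⟨
    ∑² (via R Q S) ≤⟨ ∑²-mono pointwise ⟩
    τ R S ∎
    where
    open ≤-Reasoning
    pointwise : ∀ a b → via R Q S a b ≤ 𝟙 (disagree R S a b)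
    pointwise a b = 𝟙-disjoint (λ d → left (disagree⇒ R Q d)) (λ d → right (disagree⇒ Q S d))
      (λ d d′ → asym {R = Q} LQ (proj₁ (disagree⇒ Q S d′)) (proj₂ (disagree⇒ R Q d)))
      where
      left : rel R a b × rel Q b a → T (disagree R S a b)
      left (Rab , Qba) with total {R = S} LS (distinct {R = R} LR Rab)
      ... | inj₁ Sab = ⊥-elim (asym {R = Q} LQ (R∩S⊆Q a b Rab Sab) Qba)
      ... | inj₂ Sba = ⇒disagree R S Rab Sba
      right : rel Q a b × rel S b a → T (disagree R S a b)
      right (Qab , Sba) with total {R = R} LR (distinct {R = Q} LQ Qab)
      ... | inj₁ Rab = ⇒disagree R S Rab Sba
      ... | inj₂ Rba = ⊥-elim (asym {R = Q} LQ Qab (R∩S⊆Q b a Rba Sba))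

  -- Conversely, additivity forces Q ∈ [R, S]: the triangle inequality is
  -- then tight at every pair, and a pair ranked a > b by R and S but b > a
  -- by Q would be a disagreement between R and S.
  τ-additive⇒between : ∀ {R S Q : Rel n} → IsLinOrd R → IsLinOrd S → IsLinOrd Q →
    τ R Q + τ Q S ≤ τ R S → InInterval R S Q
  τ-additive⇒between {R} {S} {Q} LR LS LQ additive = LQ , R∩S⊆Q
    where
    tight : ∀ a b → via R Q S a b ≤ 𝟙 (disagree R S a b)
    tight = ∑²-tight (disagree-triangle {R = R} {S} {Q} LR LQ)
      (≤-trans (≤-reflexive (τ-via R Q S)) additive)
    R∩S⊆Q : ∀ a b → rel R a b → rel S a b → rel Q a b
    R∩S⊆Q a b Rab Sab with total {R = Q} LQ (distinct {R = R} LR Rab)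
    ... | inj₁ Qab = Qab
    ... | inj₂ Qba = ⊥-elim (asym {R = S} LS Sab (proj₂ (disagree⇒ R S RSdisagree)))
      where
      RSdisagree : T (disagree R S a b)
      RSdisagree = 𝟙-pos⁻¹ (≤-trans (𝟙-pos (⇒disagree R Q Rab Qba))
        (m+n≤o⇒m≤o _ (tight a b)))

  τ-self : ∀ {R : Rel n} → IsLinOrd R → τ R R ≤ 0
  τ-self {R} LR = ≤-trans (∑²-mono nowhere) (≤-reflexive (∑²-zeros n))
    where
    nowhere : ∀ a b → 𝟙 (disagree R R a b) ≤ 0
    nowhere a b = 𝟙-mono {q = false} λ d →
      asym {R = R} LR (proj₁ (disagree⇒ R R d)) (proj₂ (disagree⇒ R R d))

  -- Linear orders at distance zero coincide: without disagreements R ⊆ S.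
  τ-zero : ∀ {R S : Rel n} → IsLinOrd R → IsLinOrd S → τ R S ≤ 0 → R ≡ S
  τ-zero {R} {S} LR LS τ≤0 = linear-⊆⇒≡ LR LS R⊆S
    where
    R⊆S : R ⊆ S
    R⊆S a b Rab with total {R = S} LS (distinct {R = R} LR Rab)
    ... | inj₁ Sab = Sab
    ... | inj₂ Sba = ⊥-elim (<⇒≱ (𝟙-pos (⇒disagree R S Rab Sba))
                              (∑²-zero τ≤0 a b))

  swap-keeps : ∀ {R R′ : Rel n} → IsLinOrd R → (sw : SwapAdjacent R R′) →
    ∀ x y → ¬ (x ≡ proj₁ sw × y ≡ proj₁ (proj₂ sw)) → rel R x y → rel R′ x y
  swap-keeps {R} LR (a , b , _ , Rab , _ , _ , _ , keep , _) x y not-ab Rxy =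
    keep x y not-ab not-ba Rxy
    where
    not-ba : ¬ (x ≡ b × y ≡ a)
    not-ba (refl , refl) = asym {R = R} LR Rab Rxy

  τ-swap : ∀ {R R′ W : Rel n} → IsLinOrd R → SwapAdjacent R R′ → τ R W ≤ τ R′ W + 1
  τ-swap {R} {R′} {W} LR sw@(a , b , _) =
    ∑²-mono-but-one a b
      (λ x y not-ab → 𝟙-mono λ d →
        ⇒disagree R′ W (swap-keeps {R = R} {R′} LR sw x y not-ab (proj₁ (disagree⇒ R W d)))
                       (proj₂ (disagree⇒ R W d)))
      (≤-trans (𝟙≤1 _) (m≤n+m 1 _))

module _ {V : Set} {E : V → V → Set} where

  _++_ : ∀ {u v w} → Walk E u v → Walk E v w → Walk E u w
  []      ++ q = q
  (e ∷ p) ++ q = e ∷ (p ++ q)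

  len-++ : ∀ {u v w} (p : Walk E u v) (q : Walk E v w) → len E (p ++ q) ≡ len E p + len E q
  len-++ []      q = refl
  len-++ (e ∷ p) q = cong suc (len-++ p q)

  onWalk-++ : ∀ {u x v} (p : Walk E u x) (q : Walk E x v) → OnWalk E x (p ++ q)
  onWalk-++ []      q = here
  onWalk-++ (e ∷ p) q = there (onWalk-++ p q)

  split-at : ∀ {x u v} {p : Walk E u v} → OnWalk E x p →
    Σ (Walk E u x) λ p₁ → Σ (Walk E x v) λ p₂ → len E p₁ + len E p₂ ≡ len E p
  split-at {p = p} here = [] , p , refl
  split-at (there {e = e} x∈p) with split-at x∈p
  ... | p₁ , p₂ , eq = e ∷ p₁ , p₂ , cong suc eq

module Geodesics {V : Set} (E : V → V → Set) (d : V → V → ℕ)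
  (walk-≥ : ∀ {u v} (p : Walk E u v) → d u v ≤ len E p)
  (walk-≤ : ∀ u v → Σ (Walk E u v) λ p → len E p ≤ d u v) where

  connected : IsConnectedGraph E
  connected u v = proj₁ (walk-≤ u v)

  onGeodesic⇒additive : ∀ {u v x} → OnGeodesic E u v x → d u x + d x v ≤ d u v
  onGeodesic⇒additive {u} {v} {x} (p , shortest , x∈p) with split-at x∈p
  ... | p₁ , p₂ , len-p = begin
    d u x + d x v        ≤⟨ +-mono-≤ (walk-≥ p₁) (walk-≥ p₂) ⟩
    len E p₁ + len E p₂  ≡⟨ len-p ⟩
    len E p              ≤⟨ shortest (proj₁ (walk-≤ u v)) ⟩
    len E (proj₁ (walk-≤ u v)) ≤⟨ proj₂ (walk-≤ u v) ⟩
    d u v ∎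
    where open ≤-Reasoning

  additive⇒onGeodesic : ∀ {u v x} → d u x + d x v ≤ d u v → OnGeodesic E u v x
  additive⇒onGeodesic {u} {v} {x} additive = p₁ ++ p₂ , shortest , onWalk-++ p₁ p₂
    where
    p₁ : Walk E u x
    p₁ = proj₁ (walk-≤ u x)
    p₂ : Walk E x v
    p₂ = proj₁ (walk-≤ x v)
    shortest : Shortest E (p₁ ++ p₂)
    shortest q = begin
      len E (p₁ ++ p₂)     ≡⟨ len-++ p₁ p₂ ⟩
      len E p₁ + len E p₂  ≤⟨ +-mono-≤ (proj₂ (walk-≤ u x)) (proj₂ (walk-≤ x v)) ⟩
      d u x + d x v        ≤⟨ additive ⟩
      d u v                ≤⟨ walk-≥ q ⟩
      len E q ∎
      where open ≤-Reasoning

-- Relations on Fin n are searchable, which makes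
-- "some order of 𝒟 lies strictly inside [R, S]" decidable.
Searchable : Set → Set₁
Searchable A = ∀ {P : A → Set} → (∀ a → Dec (P a)) → Dec (Σ A P)

Bool-searchable : Searchable Bool
Bool-searchable {P} P? = map′ from-⊎ to-⊎ (P? true ⊎-dec P? false)
  where
  from-⊎ : P true ⊎ P false → Σ Bool P
  from-⊎ (inj₁ p) = true , p
  from-⊎ (inj₂ p) = false , p
  to-⊎ : Σ Bool P → P true ⊎ P false
  to-⊎ (true , p)  = inj₁ p
  to-⊎ (false , p) = inj₂ p

Vec-searchable : ∀ {A} m → Searchable A → Searchable (Vec A m)
Vec-searchable zero    _      P? = map′ ([] ,_) (λ { ([] , p) → p }) (P? [])
Vec-searchable (suc m) search P? =
  map′ (λ (a , v , p) → a ∷ v , p) (λ { (a ∷ v , p) → a , v , p })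
    (search (λ a → Vec-searchable m search (λ v → P? (a ∷ v))))

Rel-searchable : ∀ n → Searchable (Rel n)
Rel-searchable n = Vec-searchable n (Vec-searchable n Bool-searchable)

module _ {n : ℕ} where

  _≟R_ : (R S : Rel n) → Dec (R ≡ S)
  _≟R_ = ≡-dec (≡-dec _≟B_)

  isLinOrd? : (Q : Rel n) → Dec (IsLinOrd Q)
  isLinOrd? Q =
    all? (λ x → ¬? (T? _)) ×-dec
    all? (λ x → all? λ y → all? λ z → T? _ →-dec (T? _ →-dec T? _)) ×-dec
    all? (λ x → all? λ y → ¬? (x ≟F y) →-dec (T? _ ⊎-dec T? _))

  inInterval? : (R S Q : Rel n) → Dec (InInterval R S Q)
  inInterval? R S Q = isLinOrd? Q ×-dec all? (λ x → all? λ y → T? _ →-dec (T? _ →-dec T? _))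

  IsMedianOf : Rel n → Rel n → Rel n → Rel n → Set
  IsMedianOf R₁ R₂ R₃ Q = InInterval R₁ R₂ Q × InInterval R₁ R₃ Q × InInterval R₂ R₃ Q

  -- A linear median Q is contained in every median Q′: if a Q b, two of
  -- R₁, R₂, R₃ agree on the pair; they cannot rank b above a, as that
  -- would force b Q a, so they rank a above b, which forces a Q′ b.
  linear-median⊆median : ∀ {R₁ R₂ R₃ Q Q′ : Rel n} →
    IsLinOrd R₁ → IsLinOrd R₂ → IsLinOrd R₃ → IsLinOrd Q →
    IsMedianOf R₁ R₂ R₃ Q → IsMedianOf R₁ R₂ R₃ Q′ → Q ⊆ Q′
  linear-median⊆median {R₁} {R₂} {R₃} {Q} L₁ L₂ L₃ LQ
    ((_ , q₁₂) , (_ , q₁₃) , (_ , q₂₃)) ((_ , q₁₂′) , (_ , q₁₃′) , (_ , q₂₃′)) a b Qab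
    with total {R = R₁} L₁ a≢b | total {R = R₂} L₂ a≢b | total {R = R₃} L₃ a≢b
    where
    a≢b : a ≢ b
    a≢b = distinct {R = Q} LQ Qab
  ... | inj₁ ab₁ | inj₁ ab₂ | _        = q₁₂′ a b ab₁ ab₂
  ... | inj₁ ab₁ | inj₂ _   | inj₁ ab₃ = q₁₃′ a b ab₁ ab₃
  ... | inj₂ _   | inj₁ ab₂ | inj₁ ab₃ = q₂₃′ a b ab₂ ab₃
  ... | inj₁ _   | inj₂ ba₂ | inj₂ ba₃ = ⊥-elim (asym {R = Q} LQ Qab (q₂₃ b a ba₂ ba₃))
  ... | inj₂ ba₁ | inj₁ _   | inj₂ ba₃ = ⊥-elim (asym {R = Q} LQ Qab (q₁₃ b a ba₁ ba₃))
  ... | inj₂ ba₁ | inj₂ ba₂ | _        = ⊥-elim (asym {R = Q} LQ Qab (q₁₂ b a ba₁ ba₂))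

  linear-median-unique : ∀ {R₁ R₂ R₃ Q Q′ : Rel n} →
    IsLinOrd R₁ → IsLinOrd R₂ → IsLinOrd R₃ → IsLinOrd Q → IsLinOrd Q′ →
    IsMedianOf R₁ R₂ R₃ Q → IsMedianOf R₁ R₂ R₃ Q′ → Q ≡ Q′
  linear-median-unique {R₁} {R₂} {R₃} {Q} {Q′} L₁ L₂ L₃ LQ LQ′ median median′ =
    linear-⊆⇒≡ LQ LQ′ (linear-median⊆median {R₁} {R₂} {R₃} {Q} {Q′} L₁ L₂ L₃ LQ median median′)

module Γ {n : ℕ} (D : Domain n) (isD : IsDomain D) (conn : IsConnectedDomain D) where

  linear : (u : Vertex D) → IsLinOrd (proj₁ u)
  linear (R , R∈D) = isD R R∈D

  dist : Vertex D → Vertex D → ℕ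
  dist u v = τ (proj₁ u) (proj₁ v)

  -- Membership in 𝒟 is proof-irrelevant, so vertices are their orders.
  vertex-≡ : {u v : Vertex D} → proj₁ u ≡ proj₁ v → u ≡ v
  vertex-≡ {R , p} {.R , q} refl = cong (R ,_) (T-irrelevant p q)

  dist-pos : {u v : Vertex D} → proj₁ u ≢ proj₁ v → 0 < dist u v
  dist-pos {u} {v} u≢v =
    ≰⇒> λ dist≤0 → u≢v (τ-zero {R = proj₁ u} {proj₁ v} (linear u) (linear v) dist≤0)

  -- Every edge is an adjacent swap, so a walk is at least as long as τ.
  walk-≥ : ∀ {u w} (p : Walk (Adj D) u w) → dist u w ≤ len (Adj D) p
  walk-≥ {u} [] = τ-self {R = proj₁ u} (linear u)
  walk-≥ {u} {w} (_∷_ {v = v} e p) = begin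
    dist u w          ≤⟨ τ-swap {R = proj₁ u} {proj₁ v} {proj₁ w} (linear u) (conn u v e) ⟩
    dist v w + 1      ≡⟨ +-comm _ 1 ⟩
    suc (dist v w)    ≤⟨ s≤s (walk-≥ p) ⟩
    suc (len (Adj D) p) ∎
    where open ≤-Reasoning

  StrictlyBetween : Vertex D → Vertex D → Rel n → Set
  StrictlyBetween u v Q =
    Q ∈D D × InInterval (proj₁ u) (proj₁ v) Q × Q ≢ proj₁ u × Q ≢ proj₁ v

  between-or-adjacent : (u v : Vertex D) → proj₁ u ≢ proj₁ v →
    Σ (Rel n) (StrictlyBetween u v) ⊎ Adj D u v
  between-or-adjacent u v u≢v with Rel-searchable n strictly-between?
    where
    strictly-between? : ∀ Q → Dec (StrictlyBetween u v Q)
    strictly-between? Q = T? (D Q) ×-dec inInterval? (proj₁ u) (proj₁ v) Q ×-dec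
                          ¬? (Q ≟R proj₁ u) ×-dec ¬? (Q ≟R proj₁ v)
  ... | yes found = inj₁ found
  ... | no none   = inj₂ (u≢v , endpoint)
    where
    endpoint : ∀ Q → Q ∈D D → InInterval (proj₁ u) (proj₁ v) Q → Q ≡ proj₁ u ⊎ Q ≡ proj₁ v
    endpoint Q Q∈D Q∈[u,v] with Q ≟R proj₁ u | Q ≟R proj₁ v
    ... | yes Q≡u | _       = inj₁ Q≡u
    ... | no _    | yes Q≡v = inj₂ Q≡v
    ... | no Q≢u  | no Q≢v  = ⊥-elim (none (Q , Q∈D , Q∈[u,v] , Q≢u , Q≢v))

  between-closer : ∀ {u v q} → InInterval (proj₁ u) (proj₁ v) (proj₁ q) →
    proj₁ q ≢ proj₁ u → proj₁ q ≢ proj₁ v → dist u q < dist u v × dist q v < dist u v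
  between-closer {u} {v} {q} q∈[u,v] q≢u q≢v =
    <-≤-trans (m<m+n _ (dist-pos {q} {v} q≢v)) additive ,
    <-≤-trans (m<n+m _ (dist-pos {u} {q} (q≢u ∘ sym))) additive
    where
    additive : dist u q + dist q v ≤ dist u v
    additive = τ-between {R = proj₁ u} {proj₁ v} {proj₁ q} (linear u) (linear v) q∈[u,v]

  -- A walk of length at most τ, by induction on a bound k > τ: either
  -- u = v, or u and v are adjacent, or we join walks through an order
  -- strictly between them, whose legs are shorter.
  walk-within : ∀ k (u v : Vertex D) → dist u v < k →
    Σ (Walk (Adj D) u v) λ p → len (Adj D) p ≤ dist u v
  walk-within (suc k) u v (s≤s dist≤k) with proj₁ u ≟R proj₁ v
  ... | yes u≡v with vertex-≡ {u} {v} u≡v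
  ...   | refl = [] , z≤n
  walk-within (suc k) u v (s≤s dist≤k) | no u≢v with between-or-adjacent u v u≢v
  ... | inj₂ adjacent = adjacent ∷ [] , dist-pos {u} {v} u≢v
  ... | inj₁ (Q , Q∈D , Q∈[u,v] , Q≢u , Q≢v)
    with between-closer {u} {v} {Q , Q∈D} Q∈[u,v] Q≢u Q≢v
  ... | left< , right< with walk-within k u (Q , Q∈D) (<-≤-trans left< dist≤k)
                          | walk-within k (Q , Q∈D) v (<-≤-trans right< dist≤k)
  ... | p₁ , p₁≤ | p₂ , p₂≤ = p₁ ++ p₂ , (begin
    len (Adj D) (p₁ ++ p₂)              ≡⟨ len-++ p₁ p₂ ⟩
    len (Adj D) p₁ + len (Adj D) p₂     ≤⟨ +-mono-≤ p₁≤ p₂≤ ⟩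
    dist u (Q , Q∈D) + dist (Q , Q∈D) v ≤⟨ τ-between {R = proj₁ u} {proj₁ v} {Q}
                                             (linear u) (linear v) Q∈[u,v] ⟩
    dist u v ∎)
    where open ≤-Reasoning

  walk-≤ : ∀ u v → Σ (Walk (Adj D) u v) λ p → len (Adj D) p ≤ dist u v
  walk-≤ u v = walk-within (suc (dist u v)) u v ≤-refl

  open Geodesics (Adj D) dist walk-≥ walk-≤ public

  onGeodesic⇔between : ∀ {u v x} →
    OnGeodesic (Adj D) u v x ⇔ InInterval (proj₁ u) (proj₁ v) (proj₁ x)
  onGeodesic⇔between {u} {v} {x} = mk⇔
    (λ geo → τ-additive⇒between {R = U} {V} {X} (linear u) (linear v) (linear x)
               (onGeodesic⇒additive geo))
    (λ between → additive⇒onGeodesic (τ-between {R = U} {V} {X} (linear u) (linear v) between))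
    where
    U V X : Rel n
    U = proj₁ u
    V = proj₁ v
    X = proj₁ x

  GeodesicMedian : Vertex D → Vertex D → Vertex D → Vertex D → Set
  GeodesicMedian u v w m =
    OnGeodesic (Adj D) u v m × OnGeodesic (Adj D) u w m × OnGeodesic (Adj D) v w m

  geodesicMedian⇔median : ∀ {u v w m} →
    GeodesicMedian u v w m ⇔ IsMedianOf (proj₁ u) (proj₁ v) (proj₁ w) (proj₁ m)
  geodesicMedian⇔median = mk⇔
    (λ (uv , uw , vw) → to uv , to uw , to vw)
    (λ (uv , uw , vw) → from uv , from uw , from vw)
    where
    to : ∀ {a b x} → OnGeodesic (Adj D) a b x → InInterval (proj₁ a) (proj₁ b) (proj₁ x)
    to = Equivalence.to onGeodesic⇔between
    from : ∀ {a b x} → InInterval (proj₁ a) (proj₁ b) (proj₁ x) → OnGeodesic (Adj D) a b x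
    from = Equivalence.from onGeodesic⇔between

  geodesicMedian-unique : ∀ {u v w m m′} →
    GeodesicMedian u v w m → GeodesicMedian u v w m′ → m′ ≡ m
  geodesicMedian-unique {u} {v} {w} {m} {m′} median median′ = vertex-≡
    (linear-median-unique {R₁ = proj₁ u} {proj₁ v} {proj₁ w} {proj₁ m′} {proj₁ m}
      (linear u) (linear v) (linear w) (linear m′) (linear m)
      (Equivalence.to geodesicMedian⇔median median′) (Equivalence.to geodesicMedian⇔median median))

corollary3p1 : (n : ℕ) (D : Domain n) → IsDomain D → IsConnectedDomain D →
    IsMedianDomain D ⇔ IsMedianGraph (Adj D)
corollary3p1 n D isD conn = mk⇔ domain⇒graph graph⇒domain
  where
  open Γ D isD conn

  domain⇒graph : IsMedianDomain D → IsMedianGraph (Adj D)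
  domain⇒graph median-domain = connected , median
    where
    median : ∀ u v w → Σ (Vertex D) λ m → GeodesicMedian u v w m ×
      (∀ m′ → OnGeodesic (Adj D) u v m′ → OnGeodesic (Adj D) u w m′ →
              OnGeodesic (Adj D) v w m′ → m′ ≡ m)
    median (R₁ , p₁) (R₂ , p₂) (R₃ , p₃) with median-domain R₁ R₂ R₃ p₁ p₂ p₃
    ... | R , R∈D , R-median =
      (R , R∈D) , on-geodesics , λ m′ uv uw vw → geodesicMedian-unique on-geodesics (uv , uw , vw)
      where
      on-geodesics : GeodesicMedian (R₁ , p₁) (R₂ , p₂) (R₃ , p₃) (R , R∈D)
      on-geodesics = Equivalence.from geodesicMedian⇔median R-median

  graph⇒domain : IsMedianGraph (Adj D) → IsMedianDomain D
  graph⇒domain (_ , median) R₁ R₂ R₃ p₁ p₂ p₃ with median (R₁ , p₁) (R₂ , p₂) (R₃ , p₃)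
  ... | (R , R∈D) , on-geodesics , _ = R , R∈D , Equivalence.to geodesicMedian⇔median on-geodesics
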